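{- Let $a,b$ be relatively prime positive integers with $a<b$, and suppose that if $a=1$ then $b$ is even. Consider the subtraction game $\mathcal{S}(a,b)$. If $a+1<b\le 2a$, then the subtraction set $\{a,b\}$ has expansion $\{a,a+1,\ldots,b\}^{*(a+b)}$. If either $a=1$, or $b=a+1$, or $b>2a$, then the subtraction set $\{a,b\}$ is non-expandable.
   Context: For a finite set $S=\{s_1<\cdots<s_k\}$ of positive integers, the subtraction game $\mathcal{S}(S)=\mathcal{S}(s_1,\ldots,s_k)$ is played on a single pile of coins: two players alternately remove $s\in S$ coins (with $s$ at most the pile size); the player making the last move wins. The nim-value of a pile of $n$ coins is $\mathcal{G}(n)=\operatorname{mex}\{\mathcal{G}(n-s): s\in S,\ s\le n\}$, and $(\mathcal{G}(n))_{n\ge 0}$ is the nim-sequence. The game is ultimately periodic with period $p$ and pre-period $n_0$ if $\mathcal{G}(n+p)=\mathcal{G}(n)$ for all $n\ge n_0$, with $p$ and $n_0$ the least such; it is periodic if $n_0=0$. (For $\mathcal{S}(a,b)$ as in the claim, the game is periodic with period $a+b$.) The expansion of $S$ is $S^{ex}=\{s\ge 1 : \mathcal{G}(n+s)\ne\mathcal{G}(n)\text{ for all } n\ge 0\}$ (the positive integers that can be added to $S$ without changing the nim-sequence); "the subtraction set has expansion $T$" means $S^{ex}=T$. For a set $X$ of positive integers and $p\ge1$, $X^{*p}=\{x+mp: x\in X, m\ge 0\}$. The subtraction set $S$ is non-expandable if $S^{ex}=S$ or $S^{ex}=S^{*p}$, where $p$ is the period of $\mathcal{S}(S)$. -}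

module Defs where

open import Data.Nat using (ℕ; zero; suc; _+_; _*_; _∸_; _≤_; _<_)
open import Data.Nat.Properties using (_≟_)
open import Data.List using (List; []; _∷_; length; mapMaybe)
open import Data.List.Membership.Propositional using (_∈_)
open import Data.List.Membership.DecPropositional _≟_ using (_∈?_)
open import Data.Maybe using (Maybe; just; nothing)
open import Data.Product using (_×_; ∃-syntax)
open import Data.Sum using (_⊎_)
open import Relation.Nullary using (¬_; yes; no)
open import Relation.Binary.PropositionalEquality using (_≡_)

-- mex of a finite list of naturals: least k not in the list
-- (the mex is at most the length, so length+1 steps of search suffice)
mexFrom : ℕ → ℕ → List ℕ → ℕ
mexFrom zero    k xs = k
mexFrom (suc f) k xs with k ∈? xs
... | yes _ = mexFrom f (suc k) xs
... | no  _ = k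

mex : List ℕ → ℕ
mex xs = mexFrom (suc (length xs)) 0 xs

at : List ℕ → ℕ → Maybe ℕ
at []       _       = nothing
at (x ∷ xs) zero    = just x
at (x ∷ xs) (suc k) = at xs k

-- given h = [G(n-1), ..., G(0)], option s gives G(n-s) when 1 ≤ s ≤ n
opt : List ℕ → ℕ → Maybe ℕ
opt h zero    = nothing
opt h (suc k) = at h k

hist : List ℕ → ℕ → List ℕ
hist S zero    = []
hist S (suc n) = mex (mapMaybe (opt (hist S n)) S) ∷ hist S n

nim : List ℕ → ℕ → ℕ
nim S n = mex (mapMaybe (opt (hist S n)) S)

SameSet : (ℕ → Set) → (ℕ → Set) → Set
SameSet P Q = ∀ s → (P s → Q s) × (Q s → P s)

Expansion : List ℕ → ℕ → Set
Expansion S s = 1 ≤ s × (∀ n → ¬ (nim S (n + s) ≡ nim S n))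

Star : (ℕ → Set) → ℕ → ℕ → Set
Star X p s = ∃[ x ] ∃[ m ] (X x × s ≡ x + m * p)

Interval : ℕ → ℕ → ℕ → Set
Interval a b s = a ≤ s × s ≤ b

UltPeriodic : List ℕ → ℕ → Set
UltPeriodic S p = ∃[ n0 ] (∀ n → n0 ≤ n → nim S (n + p) ≡ nim S n)

Period : List ℕ → ℕ → Set
Period S p = 1 ≤ p × UltPeriodic S p × (∀ q → 1 ≤ q → UltPeriodic S q → p ≤ q)

InSet : List ℕ → ℕ → Set
InSet S s = s ∈ S

NonExpandable : List ℕ → Set
NonExpandable S = ∃[ p ] (Period S p ×
  (SameSet (Expansion S) (InSet S) ⊎ SameSet (Expansion S) (Star (InSet S) p)))

module Submission where

-- Cut a period [0,p) into blocks of length a and let β r be the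
-- parity of the block index r / a.  The nim-value at m * p + r (r < p) is
-- F r = 1 in an odd block, and otherwise 0 below b and 2 from b on.  This is
-- proved by strong induction on the position: each step is one of four finite
-- mex evaluations on these values (mex-first-block ... mex-last).
--
-- By the closed form, G(n + s) ≠ G(n) for all n exactly when the
-- residue t = s % p is good: F r ≠ F ((r + t) mod p) for every r < p; a bad
-- residue (some r keeps its value) excludes every s ≡ t.  A residue is in
-- the expansion iff it is good, so the expansion is X^{*p} as soon as X
-- contains exactly the good residues (expansion-from-residues); the least
-- period is p as soon as every 0 < q < p changes some value (least-period).
--
-- Residues below a or above b are bad, a and b are good.  A
-- middle residue a < t < b is good when b ≤ 2a (ShortRange: a period is then
-- three zones with values 0, 1, 2) and bad when 2a < b (CoprimeCase); every
-- middle shift changes some value.  The coprimality hypotheses enter only to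
-- rule out complementary multiples of a with equal block parity.

open import Defs
open import Data.Nat using (ℕ; _+_; _*_; _≤_; _<_)
open import Data.Nat.Divisibility using (_∣_)
open import Data.Nat.Coprimality using (Coprime)
open import Data.List using (List; []; _∷_)
open import Data.Product using (_×_)
open import Data.Sum using (_⊎_)
open import Relation.Binary.PropositionalEquality using (_≡_)

open import Data.Bool using (Bool; true; false)
open import Data.Empty using (⊥-elim)
open import Data.List.Relation.Unary.Any using (here; there)
open import Data.Maybe using (just; nothing)
open import Data.Nat using (zero; suc; _∸_; s≤s; NonZero; >-nonZero; >-nonZero⁻¹; parity)
open import Data.Nat.DivMod
open import Data.Nat.Divisibility using (divides; ∣m+n∣m⇒∣n; ∣m∣n⇒∣m+n; ∣-refl; m%n≡0⇒n∣m)
open import Data.Nat.Induction using (<-rec)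
open import Data.Nat.Properties
open import Data.Nat.Tactic.RingSolver using (solve-∀)
open import Data.Parity.Base as ℙ using (Parity; 0ℙ; 1ℙ; _⁻¹)
open import Data.Parity.Properties using (+-homo-+; *-homo-*; p+p≡0ℙ; p≢p⁻¹; ⁻¹-involutive)
open import Data.Product using (∃-syntax; _,_; proj₁; proj₂)
open import Data.Sum using (inj₁; inj₂)
open import Relation.Binary.Definitions using (tri<; tri≈; tri>)
open import Relation.Binary.PropositionalEquality
  using (_≢_; refl; sym; trans; cong; cong₂; subst; subst₂; module ≡-Reasoning)
open import Relation.Nullary using (yes; no; contradiction)
open import Relation.Nullary.Decidable using (⌊_⌋)

open ≡-Reasoning

at-hist : ∀ S n k → k < n → at (hist S n) k ≡ just (nim S (n ∸ suc k))
at-hist S (suc n) zero    _         = refl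
at-hist S (suc n) (suc k) (s≤s k<n) = at-hist S n k k<n

at-hist-beyond : ∀ S n k → n ≤ k → at (hist S n) k ≡ nothing
at-hist-beyond S zero    k       _          = refl
at-hist-beyond S (suc n) (suc k) (s≤s n≤k) = at-hist-beyond S n k n≤k

opt-legal : ∀ S n s → 0 < s → s ≤ n → opt (hist S n) s ≡ just (nim S (n ∸ s))
opt-legal S n (suc k) _ k<n = at-hist S n k k<n

opt-illegal : ∀ S n s → n < s → opt (hist S n) s ≡ nothing
opt-illegal S n (suc k) (s≤s n≤k) = at-hist-beyond S n k n≤k

sum-minus : ∀ {n} x c → n ≡ x + c → n ∸ c ≡ x
sum-minus x c refl = m+n∸n≡m x c

summand-≤ : ∀ {n} x c → n ≡ x + c → c ≤ n
summand-≤ x c refl = m≤n+m c x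

summand-< : ∀ {n} x c → 0 < c → n ≡ x + c → x < n
summand-< x c 0<c refl = m<m+n x 0<c

-- The values of a residue of S(a,b): 1 in an odd block, otherwise 0 below b
-- (flag true) and 2 from b on (flag false).

value : Parity → Bool → ℕ
value 1ℙ _     = 1
value 0ℙ true  = 0
value 0ℙ false = 2

value-parity : ∀ u v c d → value u c ≡ value v d → u ≡ v
value-parity 0ℙ 0ℙ _     _     _  = refl
value-parity 1ℙ 1ℙ _     _     _  = refl
value-parity 0ℙ 1ℙ true  _     ()
value-parity 0ℙ 1ℙ false _     ()
value-parity 1ℙ 0ℙ _     true  ()
value-parity 1ℙ 0ℙ _     false ()

value-from-b≢0 : ∀ u → value u false ≢ 0
value-from-b≢0 0ℙ ()
value-from-b≢0 1ℙ ()

mex-first-block : ∀ u → mex (value u false ∷ 1 ∷ []) ≡ 0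
mex-first-block 0ℙ = refl
mex-first-block 1ℙ = refl

mex-one-move : ∀ u → mex (value u true ∷ []) ≡ value (u ⁻¹) true
mex-one-move 0ℙ = refl
mex-one-move 1ℙ = refl

mex-middle : ∀ u c → mex (value u true ∷ value u c ∷ []) ≡ value (u ⁻¹) true
mex-middle 0ℙ true  = refl
mex-middle 0ℙ false = refl
mex-middle 1ℙ _     = refl

mex-last : ∀ u → mex (value u true ∷ 0 ∷ []) ≡ value (u ⁻¹) false
mex-last 0ℙ = refl
mex-last 1ℙ = refl

module TwoMove (a b : ℕ) .{{a≢0 : NonZero a}} (a<b : a < b) where

  S : List ℕ
  S = a ∷ b ∷ []

  p : ℕ
  p = a + b

  G : ℕ → ℕ
  G = nim S

  0<a : 0 < a
  0<a = >-nonZero⁻¹ a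

  0<b : 0 < b
  0<b = <-trans 0<a a<b

  a<p : a < p
  a<p = m<m+n a 0<b

  b<p : b < p
  b<p = m<n+m b 0<a

  0<p : 0 < p
  0<p = <-trans 0<a a<p

  instance
    p≢0 : NonZero p
    p≢0 = >-nonZero 0<p

  nim-no-move : ∀ n → n < a → G n ≡ 0
  nim-no-move n n<a rewrite opt-illegal S n a n<a | opt-illegal S n b (<-trans n<a a<b) = refl

  nim-one-move : ∀ n x → n ≡ x + a → n < b → G n ≡ mex (G x ∷ [])
  nim-one-move n x n≡x+a n<b
    rewrite opt-legal S n a 0<a (summand-≤ x a n≡x+a) | opt-illegal S n b n<b
          | sum-minus x a n≡x+a = refl

  nim-two-moves : ∀ n x y → n ≡ x + a → n ≡ y + b → G n ≡ mex (G x ∷ G y ∷ [])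
  nim-two-moves n x y n≡x+a n≡y+b
    rewrite opt-legal S n a 0<a (summand-≤ x a n≡x+a) | opt-legal S n b 0<b (summand-≤ y b n≡y+b)
          | sum-minus x a n≡x+a | sum-minus y b n≡y+b = refl

  β : ℕ → Parity
  β r = parity (r / a)

  β-first-block : ∀ r → r < a → β r ≡ 0ℙ
  β-first-block r r<a = cong parity (m<n⇒m/n≡0 r<a)

  β-next-block : ∀ r → β (r + a) ≡ β r ⁻¹
  β-next-block r = begin
    parity ((r + a) / a)       ≡⟨ cong parity (m/n≡1+[m∸n]/n (m≤n+m a r)) ⟩
    parity (suc ((r + a ∸ a) / a)) ≡⟨ cong (λ x → parity (suc (x / a))) (m+n∸n≡m r a) ⟩
    parity (suc (r / a))       ≡⟨ +-homo-+ 1 (r / a) ⟩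
    β r ⁻¹                     ∎

  β-two-blocks : ∀ r → β (r + a + a) ≡ β r
  β-two-blocks r = trans (β-next-block (r + a)) (trans (cong _⁻¹ (β-next-block r)) (⁻¹-involutive (β r)))

  β-back : ∀ y → a ≤ y → β y ≡ β (y ∸ a) ⁻¹
  β-back y a≤y = trans (cong β (sym (m∸n+n≡m a≤y))) (β-next-block (y ∸ a))

  F : ℕ → ℕ
  F r = value (β r) ⌊ r <? b ⌋

  F-below-b : ∀ r → r < b → F r ≡ value (β r) true
  F-below-b r r<b with r <? b
  ... | yes _  = refl
  ... | no r≮b = contradiction r<b r≮b

  F-from-b : ∀ r → b ≤ r → F r ≡ value (β r) false
  F-from-b r b≤r with r <? b
  ... | yes r<b = contradiction b≤r (<⇒≱ r<b)
  ... | no _    = refl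

  F-first-block : ∀ r → r < a → F r ≡ 0
  F-first-block r r<a rewrite F-below-b r (<-trans r<a a<b) | β-first-block r r<a = refl

  F-odd-block : ∀ r → β r ≡ 1ℙ → F r ≡ 1
  F-odd-block r βr≡1 rewrite βr≡1 = refl

  F-even-below-b : ∀ r → β r ≡ 0ℙ → r < b → F r ≡ 0
  F-even-below-b r βr≡0 r<b rewrite F-below-b r r<b | βr≡0 = refl

  F-from-b≢0 : ∀ r → b ≤ r → F r ≢ 0
  F-from-b≢0 r b≤r rewrite F-from-b r b≤r = value-from-b≢0 (β r)

  F-parity : ∀ r y → F r ≡ F y → β r ≡ β y
  F-parity r y = value-parity (β r) (β y) _ _

  F-next-block≢ : ∀ r → F r ≢ F (r + a)
  F-next-block≢ r same = p≢p⁻¹ (β r) (trans (F-parity r (r + a) same) (β-next-block r))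

  F-a : F a ≡ 1
  F-a = F-odd-block a (trans (β-next-block 0) (cong _⁻¹ (β-first-block 0 0<a)))

  F-rec-first-block : ∀ r → r < a → mex (F (r + b) ∷ F (r + a) ∷ []) ≡ F r
  F-rec-first-block r r<a
    rewrite F-from-b (r + b) (m≤n+m b r)
          | F-odd-block (r + a) (trans (β-next-block r) (cong _⁻¹ (β-first-block r r<a)))
          | F-first-block r r<a
    = mex-first-block (β (r + b))

  F-rec-one-move : ∀ r → r + a < b → mex (F r ∷ []) ≡ F (r + a)
  F-rec-one-move r r+a<b
    rewrite F-below-b r (<-trans (m<m+n r 0<a) r+a<b) | F-below-b (r + a) r+a<b | β-next-block r
    = mex-one-move (β r)

  F-rec-middle : ∀ r → r + a < b → mex (F r ∷ F (r + a + a) ∷ []) ≡ F (r + a)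
  F-rec-middle r r+a<b
    rewrite F-below-b r (<-trans (m<m+n r 0<a) r+a<b) | F-below-b (r + a) r+a<b
          | β-two-blocks r | β-next-block r
    = mex-middle (β r) _

  F-rec-last : ∀ r → b ≤ r + a → r < b → mex (F r ∷ 0 ∷ []) ≡ F (r + a)
  F-rec-last r b≤r+a r<b
    rewrite F-below-b r r<b | F-from-b (r + a) b≤r+a | β-next-block r
    = mex-last (β r)

  Closed : ℕ → Set
  Closed n = ∀ m r → r < p → n ≡ m * p + r → G n ≡ F r

  Earlier : ℕ → Set
  Earlier n = ∀ {k} → k < n → Closed k

  one-move-closed : ∀ n → Earlier n → ∀ m r → r < p → n ≡ (m * p + r) + a → n < b →
                    G n ≡ mex (F r ∷ [])
  one-move-closed n ih m r r<p n≡ n<b = begin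
    G n                       ≡⟨ nim-one-move n _ n≡ n<b ⟩
    mex (G (m * p + r) ∷ [])  ≡⟨ cong (λ v → mex (v ∷ [])) (ih (summand-< _ a 0<a n≡) m r r<p refl) ⟩
    mex (F r ∷ [])            ∎

  two-moves-closed : ∀ n → Earlier n → ∀ m₁ r₁ m₂ r₂ → r₁ < p → r₂ < p →
                     n ≡ (m₁ * p + r₁) + a → n ≡ (m₂ * p + r₂) + b → G n ≡ mex (F r₁ ∷ F r₂ ∷ [])
  two-moves-closed n ih m₁ r₁ m₂ r₂ r₁<p r₂<p n≡₁ n≡₂ = begin
    G n                                          ≡⟨ nim-two-moves n _ _ n≡₁ n≡₂ ⟩
    mex (G (m₁ * p + r₁) ∷ G (m₂ * p + r₂) ∷ []) ≡⟨ cong₂ (λ u v → mex (u ∷ v ∷ []))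
                                                     (ih (summand-< _ a 0<a n≡₁) m₁ r₁ r₁<p refl)
                                                     (ih (summand-< _ b 0<b n≡₂) m₂ r₂ r₂<p refl) ⟩
    mex (F r₁ ∷ F r₂ ∷ [])                       ∎

  -- Residues r < a: terminal in the first period, otherwise the options are the
  -- residues r + b and r + a of the previous period.
  closed-first-block : ∀ n → Earlier n → ∀ m r → r < a → n ≡ m * p + r → G n ≡ F r
  closed-first-block n ih zero r r<a n≡r =
    trans (nim-no-move n (subst (_< a) (sym n≡r) r<a)) (sym (F-first-block r r<a))
  closed-first-block n ih (suc m) r r<a n≡ = begin
    G n                              ≡⟨ two-moves-closed n ih m (r + b) m (r + a) r+b<p r+a<p
                                          (trans n≡ (unwrap-a m a b r)) (trans n≡ (unwrap-b m a b r)) ⟩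
    mex (F (r + b) ∷ F (r + a) ∷ []) ≡⟨ F-rec-first-block r r<a ⟩
    F r                              ∎
    where
    r+b<p : r + b < p
    r+b<p = +-monoˡ-< b r<a
    r+a<p : r + a < p
    r+a<p = subst (r + a <_) (+-comm b a) (+-monoˡ-< a (<-trans r<a a<b))
    unwrap-a : ∀ m x y r → suc m * (x + y) + r ≡ m * (x + y) + (r + y) + x
    unwrap-a = solve-∀
    unwrap-b : ∀ m x y r → suc m * (x + y) + r ≡ m * (x + y) + (r + x) + y
    unwrap-b = solve-∀

  -- Residues r + a < b: one option r in the first period, later the residue r
  -- of the same period and the residue r + a + a of the previous one.
  closed-middle : ∀ n → Earlier n → ∀ m r → r + a < b → n ≡ m * p + (r + a) → G n ≡ F (r + a)
  closed-middle n ih zero r r+a<b n≡ = begin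
    G n            ≡⟨ one-move-closed n ih 0 r r<p n≡ (subst (_< b) (sym n≡) r+a<b) ⟩
    mex (F r ∷ []) ≡⟨ F-rec-one-move r r+a<b ⟩
    F (r + a)      ∎
    where
    r<p : r < p
    r<p = <-trans (m<m+n r 0<a) (<-trans r+a<b b<p)
  closed-middle n ih (suc m) r r+a<b n≡ = begin
    G n                                ≡⟨ two-moves-closed n ih (suc m) r m (r + a + a) r<p r+2a<p
                                            (trans n≡ (sym (+-assoc (suc m * p) r a)))
                                            (trans n≡ (unwrap-b m a b r)) ⟩
    mex (F r ∷ F (r + a + a) ∷ [])     ≡⟨ F-rec-middle r r+a<b ⟩
    F (r + a)                          ∎
    where
    r<p : r < p
    r<p = <-trans (m<m+n r 0<a) (<-trans r+a<b b<p)
    r+2a<p : r + a + a < p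
    r+2a<p = subst (r + a + a <_) (+-comm b a) (+-monoˡ-< a r+a<b)
    unwrap-b : ∀ m x y r → suc m * (x + y) + (r + x) ≡ m * (x + y) + (r + x + x) + y
    unwrap-b = solve-∀

  -- Residues b ≤ r + a < p: the options are the residues r and r + a ∸ b < a
  -- of the same period.
  closed-last : ∀ n → Earlier n → ∀ m r → b ≤ r + a → r + a < p → n ≡ m * p + (r + a) → G n ≡ F (r + a)
  closed-last n ih m r b≤r+a r+a<p n≡ = begin
    G n                    ≡⟨ two-moves-closed n ih m r m y r<p y<p
                                (trans n≡ (sym (+-assoc (m * p) r a)))
                                (trans n≡ (trans (cong (m * p +_) (sym y+b≡r+a)) (sym (+-assoc (m * p) y b)))) ⟩
    mex (F r ∷ F y ∷ [])   ≡⟨ cong (λ v → mex (F r ∷ v ∷ [])) (F-first-block y y<a) ⟩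
    mex (F r ∷ 0 ∷ [])     ≡⟨ F-rec-last r b≤r+a r<b ⟩
    F (r + a)              ∎
    where
    y : ℕ
    y = r + a ∸ b
    y+b≡r+a : y + b ≡ r + a
    y+b≡r+a = m∸n+n≡m b≤r+a
    r<b : r < b
    r<b = +-cancelʳ-< a r b (subst (r + a <_) (+-comm a b) r+a<p)
    y<a : y < a
    y<a = +-cancelʳ-< b y a (subst (_< a + b) (sym y+b≡r+a) r+a<p)
    r<p : r < p
    r<p = <-trans r<b b<p
    y<p : y < p
    y<p = <-trans y<a a<p

  closed-step : ∀ n → Earlier n → Closed n
  closed-step n ih m r r<p n≡ with <-≤-connex r a
  ... | inj₁ r<a = closed-first-block n ih m r r<a n≡
  ... | inj₂ a≤r with r ∸ a | m∸n+n≡m a≤r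
  ...   | r' | refl with <-≤-connex (r' + a) b
  ...     | inj₁ r'+a<b = closed-middle n ih m r' r'+a<b n≡
  ...     | inj₂ b≤r'+a = closed-last n ih m r' b≤r'+a r<p n≡

  nim-closed-form : ∀ m r → r < p → G (m * p + r) ≡ F r
  nim-closed-form m r r<p = <-rec Closed closed-step (m * p + r) m r r<p refl

  nim-residue : ∀ r → r < p → G r ≡ F r
  nim-residue = nim-closed-form 0

  nim-mod : ∀ n → G n ≡ F (n % p)
  nim-mod n = begin
    G n                   ≡⟨ cong G (trans (m≡m%n+[m/n]*n n p) (+-comm (n % p) _)) ⟩
    G (n / p * p + n % p) ≡⟨ nim-closed-form (n / p) (n % p) (m%n<n n p) ⟩
    F (n % p)             ∎

  AddMod : ℕ → ℕ → ℕ → Set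
  AddMod r t y = r + t ≡ y ⊎ r + t ≡ p + y

  addMod-exists : ∀ r t → r < p → t < p → ∃[ y ] (y < p × AddMod r t y)
  addMod-exists r t r<p t<p with <-≤-connex (r + t) p
  ... | inj₁ r+t<p = r + t , r+t<p , inj₁ refl
  ... | inj₂ p≤r+t = r + t ∸ p , m<n+o⇒m∸n<o (r + t) p (+-mono-< r<p t<p) ,
                     inj₂ (sym (m+[n∸m]≡n p≤r+t))

  addMod-% : ∀ {r t y} → y < p → AddMod r t y → (r + t) % p ≡ y
  addMod-% {y = y} y<p (inj₁ r+t≡y) = trans (cong (_% p) r+t≡y) (m<n⇒m%n≡m y<p)
  addMod-% {r} {t} {y} y<p (inj₂ r+t≡p+y) = begin
    (r + t) % p ≡⟨ cong (_% p) r+t≡p+y ⟩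
    (p + y) % p ≡⟨ cong (_% p) (+-comm p y) ⟩
    (y + p) % p ≡⟨ [m+n]%n≡m%n y p ⟩
    y % p       ≡⟨ m<n⇒m%n≡m y<p ⟩
    y           ∎

  Good : ℕ → Set
  Good t = ∀ r y → r < p → y < p → AddMod r t y → F r ≢ F y

  Bad : ℕ → Set
  Bad t = ∃[ r ] ∃[ y ] (r < p × y < p × AddMod r t y × F r ≡ F y)

  Changes : ℕ → Set
  Changes t = ∃[ r ] ∃[ y ] (r < p × y < p × AddMod r t y × F r ≢ F y)

  good⇒changes : ∀ t → t < p → Good t → Changes t
  good⇒changes t t<p good with addMod-exists 0 t 0<p t<p
  ... | y , y<p , am = 0 , y , 0<p , y<p , am , good 0 y 0<p y<p am

  nim-shift : ∀ n s {y} → y < p → AddMod (n % p) (s % p) y → G (n + s) ≡ F y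
  nim-shift n s y<p am = trans (nim-mod (n + s)) (cong F (trans (%-distribˡ-+ n s p) (addMod-% {n % p} {s % p} y<p am)))

  G-periodic : ∀ n → G (n + p) ≡ G n
  G-periodic n = trans (nim-mod (n + p)) (trans (cong F ([m+n]%n≡m%n n p)) (sym (nim-mod n)))

  good-never-repeats : ∀ s → Good (s % p) → ∀ n → G (n + s) ≢ G n
  good-never-repeats s good n same with addMod-exists (n % p) (s % p) (m%n<n n p) (m%n<n s p)
  ... | y , y<p , am = good (n % p) y (m%n<n n p) y<p am (begin
    F (n % p)  ≡⟨ sym (nim-mod n) ⟩
    G n        ≡⟨ sym same ⟩
    G (n + s)  ≡⟨ nim-shift n s y<p am ⟩
    F y        ∎)

  bad-repeats : ∀ s → Bad (s % p) → ∃[ n ] (G (n + s) ≡ G n)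
  bad-repeats s (r , y , r<p , y<p , am , same) = r , (begin
    G (r + s)  ≡⟨ nim-shift r s y<p (subst (λ x → AddMod x (s % p) y) (sym (m<n⇒m%n≡m r<p)) am) ⟩
    F y        ≡⟨ sym same ⟩
    F r        ≡⟨ sym (nim-residue r r<p) ⟩
    G r        ∎)

  changes-persist : ∀ t → t < p → Changes t → ∀ n₀ → ∃[ n ] (n₀ ≤ n × G (n + t) ≢ G n)
  changes-persist t t<p (r , y , r<p , y<p , am , differ) n₀ =
    n , ≤-trans (m≤m*n n₀ p) (m≤n+m (n₀ * p) r) , λ same → differ (begin
      F r        ≡⟨ sym (cong F n%p≡r) ⟩
      F (n % p)  ≡⟨ sym (nim-mod n) ⟩
      G n        ≡⟨ sym same ⟩
      G (n + t)  ≡⟨ nim-shift n t y<p (subst₂ (λ x z → AddMod x z y) (sym n%p≡r) (sym (m<n⇒m%n≡m t<p)) am) ⟩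
      F y        ∎)
    where
    n : ℕ
    n = r + n₀ * p
    n%p≡r : n % p ≡ r
    n%p≡r = trans ([m+kn]%n≡m%n r n₀ p) (m<n⇒m%n≡m r<p)

  least-period : (∀ q → 0 < q → q < p → Changes q) → Period S p
  least-period changes = 0<p , (0 , λ n _ → G-periodic n) , minimal
    where
    minimal : ∀ q → 1 ≤ q → UltPeriodic S q → p ≤ q
    minimal q 0<q (n₀ , periodic) with <-≤-connex q p
    ... | inj₂ p≤q = p≤q
    ... | inj₁ q<p with changes-persist q q<p (changes q 0<q q<p) n₀
    ...   | n , n₀≤n , differ = ⊥-elim (differ (periodic n n₀≤n))

  expansion-from-residues : (X : ℕ → Set) → (∀ x → X x → 0 < x × x < p) → (∀ x → X x → Good x) →
                            (∀ t → t < p → X t ⊎ Bad t) → SameSet (Expansion S) (Star X p)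
  expansion-from-residues X bounds good classify s = into , out
    where
    into : Expansion S s → Star X p s
    into (_ , never) with classify (s % p) (m%n<n s p)
    ... | inj₁ x = s % p , s / p , x , m≡m%n+[m/n]*n s p
    ... | inj₂ bad with bad-repeats s bad
    ...   | n , same = ⊥-elim (never n same)
    out : Star X p s → Expansion S s
    out (x , m , x∈X , s≡x+mp) =
      ≤-trans 0<x (subst (x ≤_) (sym s≡x+mp) (m≤m+n x (m * p))) ,
      good-never-repeats s (subst Good (sym s%p≡x) (good x x∈X))
      where
      0<x : 0 < x
      0<x = proj₁ (bounds x x∈X)
      s%p≡x : s % p ≡ x
      s%p≡x = trans (cong (_% p) s≡x+mp) (trans ([m+kn]%n≡m%n x m p) (m<n⇒m%n≡m (proj₂ (bounds x x∈X))))

  data Position (t : ℕ) : Set where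
    below-a : t < a → Position t
    at-a    : t ≡ a → Position t
    between : a < t → t < b → Position t
    at-b    : t ≡ b → Position t
    above-b : b < t → Position t

  position : ∀ t → Position t
  position t with <-cmp t a
  ... | tri< t<a _ _ = below-a t<a
  ... | tri≈ _ t≡a _ = at-a t≡a
  ... | tri> _ _ a<t with <-cmp t b
  ...   | tri< t<b _ _ = between a<t t<b
  ...   | tri≈ _ t≡b _ = at-b t≡b
  ...   | tri> _ _ b<t = above-b b<t

  -- A residue t < a carries 0 to t, both in the first block.
  bad-below-a : ∀ t → t < a → Bad t
  bad-below-a t t<a =
    0 , t , 0<p , <-trans t<a a<p , inj₁ refl , trans (F-first-block 0 0<a) (sym (F-first-block t t<a))

  -- A residue b < t < p carries p ∸ t < a to 0.
  bad-above-b : ∀ t → b < t → t < p → Bad t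
  bad-above-b t b<t t<p =
    p ∸ t , 0 , <-trans c<a a<p , 0<p , inj₂ (trans c+t≡p (sym (+-identityʳ p))) ,
    trans (F-first-block (p ∸ t) c<a) (sym (F-first-block 0 0<a))
    where
    c+t≡p : p ∸ t + t ≡ p
    c+t≡p = m∸n+n≡m (<⇒≤ t<p)
    c<a : p ∸ t < a
    c<a = +-cancelʳ-< t (p ∸ t) a (subst (_< a + t) (sym c+t≡p) (+-monoʳ-< a b<t))

  -- The moves themselves are good: a flips the block parity or wraps a residue
  -- from b on (value ≠ 0) into the first block (value 0), and b does the reverse.
  good-a : Good a
  good-a r y r<p y<p (inj₁ r+a≡y) same = F-next-block≢ r (trans same (cong F (sym r+a≡y)))
  good-a r y r<p y<p (inj₂ r+a≡p+y) same = F-from-b≢0 r b≤r (trans same (F-first-block y y<a))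
    where
    r≡y+b : r ≡ y + b
    r≡y+b = +-cancelʳ-≡ a r (y + b) (trans r+a≡p+y (rearrange a b y))
      where
      rearrange : ∀ x z y → (x + z) + y ≡ (y + z) + x
      rearrange = solve-∀
    b≤r : b ≤ r
    b≤r = summand-≤ y b r≡y+b
    y<a : y < a
    y<a = +-cancelʳ-< b y a (subst (_< a + b) r≡y+b r<p)

  good-b : Good b
  good-b r y r<p y<p (inj₁ r+b≡y) same = F-from-b≢0 y b≤y (trans (sym same) (F-first-block r r<a))
    where
    b≤y : b ≤ y
    b≤y = summand-≤ r b (sym r+b≡y)
    r<a : r < a
    r<a = +-cancelʳ-< b r a (subst (_< a + b) (sym r+b≡y) y<p)
  good-b r y r<p y<p (inj₂ r+b≡p+y) same = F-next-block≢ y (trans (sym same) (cong F r≡y+a))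
    where
    r≡y+a : r ≡ y + a
    r≡y+a = +-cancelʳ-≡ b r (y + a) (trans r+b≡p+y (rearrange a b y))
      where
      rearrange : ∀ x z y → (x + z) + y ≡ (y + x) + z
      rearrange = solve-∀

  -- Shifts 0 < q < a and b < q < p change the value of a (1) to a value 0.
  changes-below-a : ∀ q → 0 < q → q < a → Changes q
  changes-below-a q 0<q q<a =
    a ∸ q , a , <-trans c<a a<p , a<p , inj₁ c+q≡a ,
    λ same → 0≢1+n (trans (sym (F-first-block (a ∸ q) c<a)) (trans same F-a))
    where
    c+q≡a : a ∸ q + q ≡ a
    c+q≡a = m∸n+n≡m (<⇒≤ q<a)
    c<a : a ∸ q < a
    c<a = subst (a ∸ q <_) c+q≡a (m<m+n (a ∸ q) 0<q)

  changes-above-b : ∀ q → b < q → q < p → Changes q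
  changes-above-b q b<q q<p =
    a , q ∸ b , a<p , <-trans y<a a<p , inj₂ a+q≡p+y ,
    λ same → 0≢1+n (trans (sym (F-first-block (q ∸ b) y<a)) (trans (sym same) F-a))
    where
    y+b≡q : q ∸ b + b ≡ q
    y+b≡q = m∸n+n≡m (<⇒≤ b<q)
    a+q≡p+y : a + q ≡ p + (q ∸ b)
    a+q≡p+y = trans (cong (a +_) (sym y+b≡q)) (rearrange a b (q ∸ b))
      where
      rearrange : ∀ x z y → x + (y + z) ≡ (x + z) + y
      rearrange = solve-∀
    y<a : q ∸ b < a
    y<a = +-cancelʳ-< b (q ∸ b) a (subst (_< a + b) (sym y+b≡q) q<p)

  classify-interval : ∀ t → t < p → Interval a b t ⊎ Bad t
  classify-interval t t<p with position t
  ... | below-a t<a     = inj₂ (bad-below-a t t<a)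
  ... | at-a refl       = inj₁ (≤-refl , <⇒≤ a<b)
  ... | between a<t t<b = inj₁ (<⇒≤ a<t , <⇒≤ t<b)
  ... | at-b refl       = inj₁ (<⇒≤ a<b , ≤-refl)
  ... | above-b b<t     = inj₂ (bad-above-b t b<t t<p)

  interval-bounds : ∀ x → Interval a b x → 0 < x × x < p
  interval-bounds x (a≤x , x≤b) = <-≤-trans 0<a a≤x , ≤-<-trans x≤b b<p

  classify-moves : (∀ t → a < t → t < b → Bad t) → ∀ t → t < p → InSet S t ⊎ Bad t
  classify-moves middle-bad t t<p with position t
  ... | below-a t<a     = inj₂ (bad-below-a t t<a)
  ... | at-a t≡a        = inj₁ (here t≡a)
  ... | between a<t t<b = inj₂ (middle-bad t a<t t<b)
  ... | at-b t≡b        = inj₁ (there (here t≡b))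
  ... | above-b b<t     = inj₂ (bad-above-b t b<t t<p)

  moves-bounds : ∀ x → InSet S x → 0 < x × x < p
  moves-bounds x (here refl)         = 0<a , a<p
  moves-bounds x (there (here refl)) = 0<b , b<p

  moves-good : ∀ x → InSet S x → Good x
  moves-good x (here refl)         = good-a
  moves-good x (there (here refl)) = good-b

  -- When b ≤ 2a a period consists of three zones [0,a), [a,2a), [2a,p) with
  -- values 0, 1, 2, and every shift a ≤ t ≤ b moves each zone into a different one.
  module ShortRange (b≤2a : b ≤ a + a) where

    F-second-zone : ∀ y → a ≤ y → y < a + a → F y ≡ 1
    F-second-zone y a≤y y<2a =
      F-odd-block y (trans (β-back y a≤y) (cong _⁻¹ (β-first-block (y ∸ a) (m<n+o⇒m∸n<o y a y<2a))))

    F-third-zone : ∀ y → a + a ≤ y → y < p → F y ≡ 2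
    F-third-zone y 2a≤y y<p = trans (F-from-b y (≤-trans b≤2a 2a≤y)) (cong (λ u → value u false) β-even)
      where
      a≤y : a ≤ y
      a≤y = ≤-trans (m≤m+n a a) 2a≤y
      a≤y∸a : a ≤ y ∸ a
      a≤y∸a = m+n≤o⇒m≤o∸n a 2a≤y
      y∸2a<a : y ∸ a ∸ a < a
      y∸2a<a = subst (_< a) (sym (∸-+-assoc y a a))
                 (m<n+o⇒m∸n<o y (a + a) (<-≤-trans y<p (subst (p ≤_) (+-comm a (a + a)) (+-monoʳ-≤ a b≤2a))))
      β-even : β y ≡ 0ℙ
      β-even = trans (β-back y a≤y)
                 (cong _⁻¹ (trans (β-back (y ∸ a) a≤y∸a)
                   (cong _⁻¹ (β-first-block (y ∸ a ∸ a) y∸2a<a))))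

    F-after-a≢0 : ∀ y → a ≤ y → y < p → F y ≢ 0
    F-after-a≢0 y a≤y y<p with <-≤-connex y (a + a)
    ... | inj₁ y<2a = λ F≡0 → 0≢1+n (trans (sym F≡0) (F-second-zone y a≤y y<2a))
    ... | inj₂ 2a≤y = λ F≡0 → 0≢1+n (trans (sym F≡0) (F-third-zone y 2a≤y y<p))

    F-before-2a≢2 : ∀ y → y < a + a → F y ≢ 2
    F-before-2a≢2 y y<2a with <-≤-connex y a
    ... | inj₁ y<a = λ F≡2 → 0≢1+n (trans (sym (F-first-block y y<a)) F≡2)
    ... | inj₂ a≤y = λ F≡2 → 1+n≢n (trans (sym F≡2) (F-second-zone y a≤y y<2a))

    good-from-first-zone : ∀ t r y → a ≤ t → t ≤ b → r < a → y < p → AddMod r t y → F r ≢ F y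
    good-from-first-zone t r y a≤t t≤b r<a y<p (inj₁ r+t≡y) same =
      F-after-a≢0 y (subst (a ≤_) r+t≡y (≤-trans a≤t (m≤n+m t r))) y<p
        (trans (sym same) (F-first-block r r<a))
    good-from-first-zone t r y a≤t t≤b r<a y<p (inj₂ r+t≡p+y) same =
      <⇒≱ (+-mono-<-≤ r<a t≤b) (subst (p ≤_) (sym r+t≡p+y) (m≤m+n p y))

    good-from-second-zone : ∀ t r y → a ≤ t → t ≤ b → a ≤ r → r < a + a → y < p → AddMod r t y → F r ≢ F y
    good-from-second-zone t r y a≤t t≤b a≤r r<2a y<p (inj₁ r+t≡y) same =
      1+n≢n (trans (sym (F-third-zone y (subst (a + a ≤_) r+t≡y (+-mono-≤ a≤r a≤t)) y<p))
        (trans (sym same) (F-second-zone r a≤r r<2a)))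
    good-from-second-zone t r y a≤t t≤b a≤r r<2a y<p (inj₂ r+t≡p+y) same =
      0≢1+n (trans (sym (F-first-block y y<a)) (trans (sym same) (F-second-zone r a≤r r<2a)))
      where
      y<a : y < a
      y<a = +-cancelˡ-< p y a (subst₂ _<_ r+t≡p+y (rearrange a b) (+-mono-<-≤ r<2a t≤b))
        where
        rearrange : ∀ x z → x + x + z ≡ (x + z) + x
        rearrange = solve-∀

    good-from-third-zone : ∀ t r y → a ≤ t → t ≤ b → a + a ≤ r → r < p → y < p → AddMod r t y → F r ≢ F y
    good-from-third-zone t r y a≤t t≤b 2a≤r r<p y<p (inj₁ r+t≡y) same =
      <⇒≱ y<p (subst (p ≤_) r+t≡y (≤-trans p≤3a (+-mono-≤ 2a≤r a≤t)))
      where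
      p≤3a : p ≤ a + a + a
      p≤3a = subst (p ≤_) (+-comm a (a + a)) (+-monoʳ-≤ a b≤2a)
    good-from-third-zone t r y a≤t t≤b 2a≤r r<p y<p (inj₂ r+t≡p+y) same =
      F-before-2a≢2 y (<-≤-trans y<b b≤2a) (trans (sym same) (F-third-zone r 2a≤r r<p))
      where
      y<b : y < b
      y<b = +-cancelˡ-< p y b (subst (_< p + b) r+t≡p+y (+-mono-<-≤ r<p t≤b))

    good-interval : ∀ t → a ≤ t → t ≤ b → Good t
    good-interval t a≤t t≤b r y r<p y<p with <-≤-connex r a
    ... | inj₁ r<a = good-from-first-zone t r y a≤t t≤b r<a y<p
    ... | inj₂ a≤r with <-≤-connex r (a + a)
    ...   | inj₁ r<2a = good-from-second-zone t r y a≤t t≤b a≤r r<2a y<p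
    ...   | inj₂ 2a≤r = good-from-third-zone t r y a≤t t≤b 2a≤r r<p y<p

  to-next-block : ∀ x → x % a ≢ 0 → ∃[ d ] (d < a × β (x + d) ≡ β x ⁻¹)
  to-next-block x x%a≢0 = a ∸ x % a , ∸-monoʳ-< {o = 0} (n≢0⇒n>0 x%a≢0) (m%n≤n x a) , flip
    where
    x+d≡ : x + (a ∸ x % a) ≡ x / a * a + a
    x+d≡ = begin
      x + (a ∸ x % a)                    ≡⟨ cong (_+ (a ∸ x % a)) (m≡m%n+[m/n]*n x a) ⟩
      x % a + x / a * a + (a ∸ x % a)    ≡⟨ rearrange (x % a) (x / a * a) (a ∸ x % a) ⟩
      x / a * a + (x % a + (a ∸ x % a))  ≡⟨ cong (x / a * a +_) (m+[n∸m]≡n (m%n≤n x a)) ⟩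
      x / a * a + a                      ∎
      where
      rearrange : ∀ c m d → c + m + d ≡ m + (c + d)
      rearrange = solve-∀
    flip : β (x + (a ∸ x % a)) ≡ β x ⁻¹
    flip = begin
      β (x + (a ∸ x % a))  ≡⟨ cong β x+d≡ ⟩
      β (x / a * a + a)    ≡⟨ β-next-block (x / a * a) ⟩
      β (x / a * a) ⁻¹     ≡⟨ cong (λ k → parity k ⁻¹) (m*n/n≡m (x / a) a) ⟩
      β x ⁻¹               ∎

  multiple-beyond-a : ∀ t → a ∣ t → a < t → a + a ≤ t
  multiple-beyond-a t (divides k t≡ka) a<t = subst (a + a ≤_) (sym t≡ka) (at-least-two k (subst (a <_) t≡ka a<t))
    where
    at-least-two : ∀ k → a < k * a → a + a ≤ k * a
    at-least-two (suc zero)    a<a+0 = contradiction (subst (a <_) (+-identityʳ a) a<a+0) (<-irrefl refl)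
    at-least-two (suc (suc k)) _     = +-monoʳ-≤ a (m≤m+n a (k * a))

  module CoprimeCase (coprime : Coprime a b) (even-if-unit : a ≡ 1 → 2 ∣ b) where

    -- Complementary multiples of a (r + t = p) lie in blocks of different parity:
    -- a ∣ r and a ∣ t force a ∣ b, so a = 1, blocks are single positions, b is
    -- even and p = 1 + b is odd.
    complementary-multiples : ∀ r t → a ∣ r → a ∣ t → r + t ≡ p → β r ≢ β t
    complementary-multiples r t a∣r a∣t r+t≡p same = contradiction (begin
      0ℙ                      ≡⟨ sym (p+p≡0ℙ (parity t)) ⟩
      parity t ℙ.+ parity t   ≡⟨ cong (ℙ._+ parity t) (sym (trans (sym (β-is-parity r)) (trans same (β-is-parity t)))) ⟩
      parity r ℙ.+ parity t   ≡⟨ sym (+-homo-+ r t) ⟩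
      parity (r + t)          ≡⟨ cong parity r+t≡p ⟩
      parity (a + b)          ≡⟨ +-homo-+ a b ⟩
      parity a ℙ.+ parity b   ≡⟨ cong₂ ℙ._+_ (cong parity a≡1) parity-b ⟩
      1ℙ                      ∎) λ ()
      where
      a≡1 : a ≡ 1
      a≡1 = coprime (∣-refl , ∣m+n∣m⇒∣n (subst (a ∣_) r+t≡p (∣m∣n⇒∣m+n a∣r a∣t)) ∣-refl)
      β-is-parity : ∀ x → β x ≡ parity x
      β-is-parity x = cong parity (trans (/-congʳ {m = x} a≡1) (n/1≡n x))
      parity-b : parity b ≡ 0ℙ
      parity-b with even-if-unit a≡1
      ... | divides q b≡q*2 = trans (cong parity (trans b≡q*2 (*-comm q 2))) (*-homo-* 2 q)

    past-complement : ∀ t → a ∣ t → t < p → β (p ∸ t) ≡ β t →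
                      ∃[ d ] (d < a × AddMod (p ∸ t + d) t d × β (p ∸ t + d) ≡ β t ⁻¹)
    past-complement t a∣t t<p same with to-next-block (p ∸ t) c%a≢0
      where
      c%a≢0 : (p ∸ t) % a ≢ 0
      c%a≢0 c%a≡0 = complementary-multiples (p ∸ t) t (m%n≡0⇒n∣m (p ∸ t) a c%a≡0) a∣t (m∸n+n≡m (<⇒≤ t<p)) same
    ... | d , d<a , flip = d , d<a , inj₂ wrap , trans flip (cong _⁻¹ same)
      where
      wrap : p ∸ t + d + t ≡ p + d
      wrap = trans (rearrange (p ∸ t) d t) (cong (_+ d) (m∸n+n≡m (<⇒≤ t<p)))
        where
        rearrange : ∀ c d t → c + d + t ≡ c + t + d
        rearrange = solve-∀

    complement-room : ∀ t c → t < p → c ≤ t → p ∸ t + c ≤ p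
    complement-room t c t<p c≤t = subst (p ∸ t + c ≤_) (m∸n+n≡m (<⇒≤ t<p)) (+-monoʳ-≤ (p ∸ t) c≤t)

    complement-below-b : ∀ t → a < t → t < p → p ∸ t < b
    complement-below-b t a<t t<p = +-cancelʳ-< a (p ∸ t) b
      (subst₂ _≤_ (+-suc (p ∸ t) a) (+-comm a b) (complement-room t (suc a) t<p a<t))

    complement-next-block-≤-b : ∀ t → a + a ≤ t → t < p → p ∸ t + a ≤ b
    complement-next-block-≤-b t 2a≤t t<p = +-cancelʳ-≤ a (p ∸ t + a) b
      (subst₂ _≤_ (sym (+-assoc (p ∸ t) a a)) (+-comm a b) (complement-room t (a + a) t<p 2a≤t))

    bad-even : ∀ t → β t ≡ 0ℙ → t < b → Bad t
    bad-even t βt≡0 t<b =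
      0 , t , 0<p , <-trans t<b b<p , inj₁ refl ,
      trans (F-first-block 0 0<a) (sym (F-even-below-b t βt≡0 t<b))

    -- 2a is even and below b; t carries it into the first block.
    bad-near-b : a + a < b → ∀ t → b ≤ t + a → t < b → Bad t
    bad-near-b 2a<b t b≤t+a t<b =
      a + a , y , <-trans 2a<b b<p , <-trans y<a a<p , inj₂ wrap ,
      trans (F-even-below-b (a + a) (trans (β-two-blocks 0) (β-first-block 0 0<a)) 2a<b)
            (sym (F-first-block y y<a))
      where
      y : ℕ
      y = t + a ∸ b
      y+b≡t+a : y + b ≡ t + a
      y+b≡t+a = m∸n+n≡m b≤t+a
      y<a : y < a
      y<a = +-cancelʳ-< b y a (subst₂ _<_ (sym y+b≡t+a) (+-comm b a) (+-monoˡ-< a t<b))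
      wrap : a + a + t ≡ p + y
      wrap = trans (rearrange a t) (trans (cong (a +_) (sym y+b≡t+a)) (rearrange′ a b y))
        where
        rearrange : ∀ x t → x + x + t ≡ x + (t + x)
        rearrange = solve-∀
        rearrange′ : ∀ x z y → x + (y + z) ≡ x + z + y
        rearrange′ = solve-∀

    -- An odd-block t that is no multiple of a carries d < a (value 0) to the
    -- start of the next, even, block (value 0 below b).
    bad-odd-non-multiple : ∀ t → β t ≡ 1ℙ → t % a ≢ 0 → t + a < b → Bad t
    bad-odd-non-multiple t βt≡1 t%a≢0 t+a<b with to-next-block t t%a≢0
    ... | d , d<a , flip =
      d , t + d , <-trans d<a a<p , <-trans t+d<b b<p , inj₁ (+-comm d t) ,
      trans (F-first-block d d<a) (sym (F-even-below-b (t + d) (trans flip (cong _⁻¹ βt≡1)) t+d<b))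
      where
      t+d<b : t + d < b
      t+d<b = <-trans (+-monoʳ-< t d<a) t+a<b

    -- An odd-block multiple t of a carries its complement (if even) or the
    -- residue just past it to the first block.
    bad-odd-multiple : ∀ t → β t ≡ 1ℙ → a ∣ t → a < t → t < b → Bad t
    bad-odd-multiple t βt≡1 a∣t a<t t<b with β (p ∸ t) in βc
    ... | 0ℙ = p ∸ t , 0 , <-trans c<b b<p , 0<p , inj₂ (trans (m∸n+n≡m (<⇒≤ t<p)) (sym (+-identityʳ p))) ,
               trans (F-even-below-b (p ∸ t) βc c<b) (sym (F-first-block 0 0<a))
      where
      t<p : t < p
      t<p = <-trans t<b b<p
      c<b : p ∸ t < b
      c<b = complement-below-b t a<t t<p
    ... | 1ℙ with past-complement t a∣t (<-trans t<b b<p) (trans βc (sym βt≡1))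
    ...   | d , d<a , wrap , flip =
      p ∸ t + d , d , <-trans r<b b<p , <-trans d<a a<p , wrap ,
      trans (F-even-below-b (p ∸ t + d) (trans flip (cong _⁻¹ βt≡1)) r<b) (sym (F-first-block d d<a))
      where
      t<p : t < p
      t<p = <-trans t<b b<p
      r<b : p ∸ t + d < b
      r<b = <-≤-trans (+-monoʳ-< (p ∸ t) d<a) (complement-next-block-≤-b t (multiple-beyond-a t a∣t a<t) t<p)

    bad-middle : a + a < b → ∀ t → a < t → t < b → Bad t
    bad-middle 2a<b t a<t t<b with β t in βt
    ... | 0ℙ = bad-even t βt t<b
    ... | 1ℙ with t % a ≟ 0
    ...   | yes t%a≡0 = bad-odd-multiple t βt (m%n≡0⇒n∣m t a t%a≡0) a<t t<b
    ...   | no t%a≢0 with <-≤-connex (t + a) b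
    ...     | inj₁ t+a<b = bad-odd-non-multiple t βt t%a≢0 t+a<b
    ...     | inj₂ b≤t+a = bad-near-b 2a<b t b≤t+a t<b

    changes-odd : ∀ t → β t ≡ 1ℙ → t < p → Changes t
    changes-odd t βt≡1 t<p =
      0 , t , 0<p , t<p , inj₁ refl ,
      λ same → 0≢1+n (trans (sym (F-first-block 0 0<a)) (trans same (F-odd-block t βt≡1)))

    changes-even-non-multiple : ∀ t → β t ≡ 0ℙ → t % a ≢ 0 → t < b → Changes t
    changes-even-non-multiple t βt≡0 t%a≢0 t<b with to-next-block t t%a≢0
    ... | d , d<a , flip =
      d , t + d , <-trans d<a a<p , t+d<p , inj₁ (+-comm d t) ,
      λ same → 0≢1+n (trans (sym (F-first-block d d<a)) (trans same (F-odd-block (t + d) (trans flip (cong _⁻¹ βt≡0)))))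
      where
      t+d<p : t + d < p
      t+d<p = subst (t + d <_) (+-comm b a) (+-mono-< t<b d<a)

    changes-even-multiple : ∀ t → β t ≡ 0ℙ → a ∣ t → a ≤ t → t < p → Changes t
    changes-even-multiple t βt≡0 a∣t a≤t t<p with β (p ∸ t) in βc
    ... | 1ℙ = p ∸ t , 0 , c<p , 0<p , inj₂ (trans (m∸n+n≡m (<⇒≤ t<p)) (sym (+-identityʳ p))) ,
               λ same → 0≢1+n (trans (sym (F-first-block 0 0<a)) (trans (sym same) (F-odd-block (p ∸ t) βc)))
      where
      c<p : p ∸ t < p
      c<p = <-≤-trans (m<m+n (p ∸ t) 0<a) (complement-room t a t<p a≤t)
    ... | 0ℙ with past-complement t a∣t t<p (trans βc (sym βt≡0))
    ...   | d , d<a , wrap , flip =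
      p ∸ t + d , d , r<p , <-trans d<a a<p , wrap ,
      λ same → 0≢1+n (trans (sym (F-first-block d d<a)) (trans (sym same) (F-odd-block (p ∸ t + d) (trans flip (cong _⁻¹ βt≡0)))))
      where
      r<p : p ∸ t + d < p
      r<p = <-≤-trans (+-monoʳ-< (p ∸ t) d<a) (complement-room t a t<p a≤t)

    changes-middle : ∀ t → a < t → t < b → Changes t
    changes-middle t a<t t<b with β t in βt
    ... | 1ℙ = changes-odd t βt (<-trans t<b b<p)
    ... | 0ℙ with t % a ≟ 0
    ...   | yes t%a≡0 = changes-even-multiple t βt (m%n≡0⇒n∣m t a t%a≡0) (<⇒≤ a<t) (<-trans t<b b<p)
    ...   | no t%a≢0  = changes-even-non-multiple t βt t%a≢0 t<b

    changes-everywhere : ∀ q → 0 < q → q < p → Changes q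
    changes-everywhere q 0<q q<p with position q
    ... | below-a q<a     = changes-below-a q 0<q q<a
    ... | at-a refl       = good⇒changes a a<p good-a
    ... | between a<q q<b = changes-middle q a<q q<b
    ... | at-b refl       = good⇒changes b b<p good-b
    ... | above-b b<q     = changes-above-b q b<q q<p

    period : Period S p
    period = least-period changes-everywhere

middle-forces-2a<b : ∀ {a b t} → (a ≡ 1 ⊎ (b ≡ a + 1 ⊎ 2 * a < b)) → a < t → t < b → a + a < b
middle-forces-2a<b             (inj₁ refl)        a<t t<b = ≤-<-trans a<t t<b
middle-forces-2a<b {a} {_} {t} (inj₂ (inj₁ refl)) a<t t<b = contradiction a<t (<⇒≱ (subst (t <_) (+-comm a 1) t<b))
middle-forces-2a<b {a} {b}     (inj₂ (inj₂ 2a<b)) _   _   = subst (_< b) (cong (a +_) (+-identityʳ a)) 2a<b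

theorem2p1 : (a b : ℕ) → 0 < a → a < b → Coprime a b → (a ≡ 1 → 2 ∣ b) →
    ((a + 1 < b → b ≤ 2 * a →
        SameSet (Expansion (a ∷ b ∷ [])) (Star (Interval a b) (a + b)))
    × ((a ≡ 1 ⊎ (b ≡ a + 1 ⊎ 2 * a < b)) → NonExpandable (a ∷ b ∷ [])))
theorem2p1 a b 0<a a<b coprime even-if-unit = interval-expansion , non-expandable
  where
  instance
    a≢0 : NonZero a
    a≢0 = >-nonZero 0<a
  open TwoMove a b a<b
  open CoprimeCase coprime even-if-unit

  interval-expansion : a + 1 < b → b ≤ 2 * a → SameSet (Expansion S) (Star (Interval a b) p)
  interval-expansion _ b≤2a =
    expansion-from-residues (Interval a b) interval-bounds
      (λ t (a≤t , t≤b) → good-interval t a≤t t≤b) classify-interval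
    where open ShortRange (subst (b ≤_) (cong (a +_) (+-identityʳ a)) b≤2a)

  non-expandable : (a ≡ 1 ⊎ (b ≡ a + 1 ⊎ 2 * a < b)) → NonExpandable S
  non-expandable range = p , period , inj₂
    (expansion-from-residues (InSet S) moves-bounds moves-good
      (classify-moves (λ t a<t t<b → bad-middle (middle-forces-2a<b range a<t t<b) t a<t t<b)))
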